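{- For every positive odd integer $x$ and every integer $n\geq1$, $\nu_2\!\left(\frac{((2n-1)!!)^x+(-1)^{(n-1)(n-2)/2}}{2}\right)=\nu_2(n)$.
   Context: $(2n-1)!!=1\cdot 3\cdots(2n-1)$; $\nu_2(m)$ is the exponent of the highest power of $2$ dividing the positive integer $m$. -}

module Defs where

open import Data.Nat using (ℕ; zero; suc; _+_; _*_; _∸_; _^_; _/_; _%_)
open import Data.Bool using (Bool; true; false; if_then_else_)
open import Data.Nat using (_≡ᵇ_)

-- double factorial of an odd number: oddDF n = (2n-1)!! = 1 · 3 ⋯ (2n-1)
oddDF : ℕ → ℕ
oddDF zero    = 1
oddDF (suc n) = oddDF n * (2 * n + 1)

-- Computed with fuel (fuel m suffices, since
-- ν₂ m ≤ m).  Convention: ν₂ 0 = 0 (never used on 0 in the statement).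
ν₂-aux : ℕ → ℕ → ℕ
ν₂-aux zero       m = 0
ν₂-aux (suc fuel) zero = 0
ν₂-aux (suc fuel) m@(suc _) =
  if m % 2 ≡ᵇ 0 then suc (ν₂-aux fuel (m / 2)) else 0

ν₂ : ℕ → ℕ
ν₂ m = ν₂-aux m m

-- (-1)^((n-1)(n-2)/2) is +1 iff ((n-1)(n-2)/2) is even.
-- numerator n x = ((2n-1)!!)^x + (-1)^((n-1)(n-2)/2), as a natural number
-- (for n ≥ 1 it is nonnegative, since (2n-1)!! ≥ 1).
signExp : ℕ → ℕ
signExp n = ((n ∸ 1) * (n ∸ 2)) / 2

numerator : ℕ → ℕ → ℕ
numerator n x =
  if signExp n % 2 ≡ᵇ 0 then oddDF n ^ x + 1 else oddDF n ^ x ∸ 1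

module Submission where

-- Write n = 2^a (2c + 1), P(n) = (2n − 1)!! and s(n) = (−1)^((n−1)(n−2)/2).  The heart of the
-- argument is P(n) + s(n) ≡ 2^(a+1) (mod 2^(a+2)).  For odd n it follows from P(n + 2) ≡ −P(n)
-- (mod 4) and the 4-periodicity of s.  For n = 2L, the factors 2L + 2i + 1 of the upper half are
-- the reflected factors 2i + 1 − 2L shifted by 4L, whence P(2L) ≡ P(L) ((−1)^L P(L) + 4L²)
-- (mod 8L); squaring the congruence for L doubles its modulus and gives the congruence for 2L.
-- Finally P(n)² ≡ 1 (mod 2^(a+2)), so P(n)^x ≡ P(n) for odd x, and the numerator
-- P(n)^x + s(n) is 2^(a+1) times an odd number.

open import Defs
open import Data.Bool using (true; false; if_then_else_)
open import Data.Empty using (⊥-elim)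
open import Data.Product using (∃; ∃₂; _,_; proj₁; proj₂; map₂)
open import Data.Sum using (_⊎_; inj₁; inj₂)
open import Function using (_$_)
open import Level using (0ℓ)
open import Relation.Binary.Bundles using (Setoid)
open import Relation.Binary.PropositionalEquality
import Relation.Binary.Reasoning.Setoid as SetoidReasoning
import Data.Nat as ℕ
import Data.Nat.DivMod as ℕ
import Data.Nat.Divisibility as ℕ
import Data.Nat.Properties as ℕ
open import Data.Nat.Tactic.RingSolver using () renaming (solve-∀ to ℕ-solve-∀)

module Congruences where

  open import Data.Nat.Base using (ℕ; zero; suc)
  open import Data.Integer.Base using (ℤ; +_; -[1+_]; _+_; _-_; -_; _*_; _^_; 1ℤ; -1ℤ)
  open import Data.Integer.Properties
    using (+-inverseʳ; +-identityʳ; *-identityˡ; *-identityʳ; *-assoc; *-comm; pos-+; pos-*; +-injective;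
           -1*i≡-i; ^-*-assoc; ^-zeroˡ; neg-involutive)
  open import Data.Integer.Divisibility.Signed
  open import Data.Integer.Tactic.RingSolver using (solve-∀)

  infix 4 _≡_mod_
  record _≡_mod_ (a b m : ℤ) : Set where
    constructor congruent
    field divides-difference : m ∣ a - b
  open _≡_mod_ using (divides-difference)

  module _ {m : ℤ} where

    ≡-mod-reflexive : ∀ {a b} → a ≡ b → a ≡ b mod m
    ≡-mod-reflexive {a} refl = congruent (divides (+ 0) (+-inverseʳ a))

    ≡-mod-refl : ∀ {a} → a ≡ a mod m
    ≡-mod-refl = ≡-mod-reflexive refl

    ≡-mod-sym : ∀ {a b} → a ≡ b mod m → b ≡ a mod m
    ≡-mod-sym {a} {b} (congruent m∣a-b) = congruent $ subst (m ∣_) (negate a b) (∣m⇒∣-m m∣a-b)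
      where
      negate : ∀ a b → - (a - b) ≡ b - a
      negate = solve-∀

    ≡-mod-trans : ∀ {a b c} → a ≡ b mod m → b ≡ c mod m → a ≡ c mod m
    ≡-mod-trans {a} {b} {c} (congruent m∣a-b) (congruent m∣b-c) =
      congruent $ subst (m ∣_) (telescope a b c) (∣m∣n⇒∣m+n m∣a-b m∣b-c)
      where
      telescope : ∀ a b c → (a - b) + (b - c) ≡ a - c
      telescope = solve-∀

    +-cong-mod : ∀ {a b c d} → a ≡ b mod m → c ≡ d mod m → a + c ≡ b + d mod m
    +-cong-mod {a} {b} {c} {d} (congruent m∣a-b) (congruent m∣c-d) =
      congruent $ subst (m ∣_) (regroup a b c d) (∣m∣n⇒∣m+n m∣a-b m∣c-d)
      where
      regroup : ∀ a b c d → (a - b) + (c - d) ≡ (a + c) - (b + d)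
      regroup = solve-∀

    *-cong-mod : ∀ {a b c d} → a ≡ b mod m → c ≡ d mod m → a * c ≡ b * d mod m
    *-cong-mod {a} {b} {c} {d} (congruent m∣a-b) (congruent m∣c-d) =
      congruent $ subst (m ∣_) (regroup a b c d) (∣m∣n⇒∣m+n (∣m⇒∣m*n c m∣a-b) (∣n⇒∣m*n b m∣c-d))
      where
      regroup : ∀ a b c d → (a - b) * c + b * (c - d) ≡ a * c - b * d
      regroup = solve-∀

    -‿cong-mod : ∀ {a b} → a ≡ b mod m → - a ≡ - b mod m
    -‿cong-mod {a} {b} (congruent m∣a-b) = congruent $ subst (m ∣_) (negate a b) (∣m⇒∣-m m∣a-b)
      where
      negate : ∀ a b → - (a - b) ≡ - a - - b
      negate = solve-∀

    +-congˡ-mod : ∀ c {a b} → a ≡ b mod m → c + a ≡ c + b mod m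
    +-congˡ-mod c = +-cong-mod (≡-mod-refl {c})

    +-congʳ-mod : ∀ c {a b} → a ≡ b mod m → a + c ≡ b + c mod m
    +-congʳ-mod c a≡b = +-cong-mod a≡b (≡-mod-refl {c})

    *-congˡ-mod : ∀ c {a b} → a ≡ b mod m → c * a ≡ c * b mod m
    *-congˡ-mod c = *-cong-mod (≡-mod-refl {c})

    ≡-mod-setoid : Setoid 0ℓ 0ℓ
    ≡-mod-setoid = record
      { Carrier       = ℤ
      ; _≈_           = _≡_mod m
      ; isEquivalence = record { refl = ≡-mod-refl ; sym = ≡-mod-sym ; trans = ≡-mod-trans }
      }

  module ≡-mod-Reasoning (m : ℤ) = SetoidReasoning (≡-mod-setoid {m})

  ≡-mod-weaken : ∀ {k m a b} → k ∣ m → a ≡ b mod m → a ≡ b mod k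
  ≡-mod-weaken k∣m (congruent m∣a-b) = congruent (∣-trans k∣m m∣a-b)

  *-scale-mod : ∀ k {m a b} → a ≡ b mod m → k * a ≡ k * b mod (k * m)
  *-scale-mod k {m} {a} {b} (congruent m∣a-b) = congruent $ subst (k * m ∣_) (distrib k a b) (*-monoʳ-∣ k m∣a-b)
    where
    distrib : ∀ k a b → k * (a - b) ≡ k * a - k * b
    distrib = solve-∀

  multiple≡0-mod : ∀ {m a} → m ∣ a → a ≡ + 0 mod m
  multiple≡0-mod {m} {a} m∣a = congruent (subst (m ∣_) (sym (+-identityʳ a)) m∣a)

  square-doubling : ∀ {m a b} → + 2 ∣ m → a ≡ b mod m → a * a ≡ b * b mod (+ 2 * m)
  square-doubling {m} {a} {b} (divides r m≡r*2) (congruent (divides q a-b≡q*m)) =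
    congruent (divides (q * q * r + b * q) (begin
      a * a - b * b                                ≡⟨ complete-square a b ⟩
      (a - b) * (a - b) + + 2 * b * (a - b)         ≡⟨ cong (λ d → d * d + + 2 * b * d) a-b≡q*m ⟩
      q * m * (q * m) + + 2 * b * (q * m)          ≡⟨ cong (λ m′ → q * m′ * (q * m) + + 2 * b * (q * m)) m≡r*2 ⟩
      q * (r * + 2) * (q * m) + + 2 * b * (q * m)  ≡⟨ regroup q r b m ⟩
      (q * q * r + b * q) * (+ 2 * m)              ∎))
    where
    open ≡-Reasoning
    complete-square : ∀ a b → a * a - b * b ≡ (a - b) * (a - b) + + 2 * b * (a - b)
    complete-square = solve-∀
    regroup : ∀ q r b m → q * (r * + 2) * (q * m) + + 2 * b * (q * m) ≡ (q * q * r + b * q) * (+ 2 * m)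
    regroup = solve-∀

  ^-odd-mod : ∀ {m} a k → a * a ≡ 1ℤ mod m → a ^ (1 ℕ.+ 2 ℕ.* k) ≡ a mod m
  ^-odd-mod a zero    a²≡1 = ≡-mod-reflexive (*-identityʳ a)
  ^-odd-mod {m} a (suc k) a²≡1 = begin
    a ^ (1 ℕ.+ 2 ℕ.* suc k)    ≡⟨ cong (a ^_) (exponent k) ⟩
    a * (a * a ^ (1 ℕ.+ 2 ℕ.* k)) ≡⟨ *-assoc a a _ ⟨
    a * a * a ^ (1 ℕ.+ 2 ℕ.* k)   ≈⟨ *-cong-mod a²≡1 (^-odd-mod a k a²≡1) ⟩
    1ℤ * a                        ≡⟨ *-identityˡ a ⟩
    a                             ∎
    where
    open ≡-mod-Reasoning m
    exponent : ∀ k → 1 ℕ.+ 2 ℕ.* suc k ≡ 2 ℕ.+ (1 ℕ.+ 2 ℕ.* k)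
    exponent = ℕ-solve-∀

  Odd : ℤ → Set
  Odd x = x ≡ 1ℤ mod + 2

  ∏ : ℕ → (ℕ → ℤ) → ℤ
  ∏ zero    f = 1ℤ
  ∏ (suc L) f = f 0 * ∏ L (λ i → f (suc i))

  ∏-cong : ∀ L {f g : ℕ → ℤ} → (∀ i → f i ≡ g i) → ∏ L f ≡ ∏ L g
  ∏-cong zero    f≗g = refl
  ∏-cong (suc L) f≗g = cong₂ _*_ (f≗g 0) (∏-cong L (λ i → f≗g (suc i)))

  ∏-+ : ∀ m L (f : ℕ → ℤ) → ∏ (m ℕ.+ L) f ≡ ∏ m f * ∏ L (λ i → f (m ℕ.+ i))
  ∏-+ zero    L f = sym (*-identityˡ _)
  ∏-+ (suc m) L f = trans (cong (f 0 *_) (∏-+ m L (λ i → f (suc i)))) (sym (*-assoc (f 0) _ _))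

  ∏-suc : ∀ L (f : ℕ → ℤ) → ∏ (suc L) f ≡ ∏ L f * f L
  ∏-suc zero    f = *-comm (f 0) 1ℤ
  ∏-suc (suc L) f = trans (cong (f 0 *_) (∏-suc L (λ i → f (suc i)))) (sym (*-assoc (f 0) _ _))

  ∏-Odd : ∀ L {f} → (∀ i → Odd (f i)) → Odd (∏ L f)
  ∏-Odd zero    f-odd = ≡-mod-refl
  ∏-Odd (suc L) f-odd = *-cong-mod (f-odd 0) (∏-Odd L (λ i → f-odd (suc i)))

  -- Expanding, every term beyond ∏ fᵢ + L t contains t² or some (fᵢ − 1) t, both divisible by 2t.
  ∏-+-even : ∀ L {f t} → + 2 ∣ t → (∀ i → Odd (f i)) →
             ∏ L (λ i → f i + t) ≡ ∏ L f + + L * t mod (+ 2 * t)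
  ∏-+-even zero            2∣t f-odd = ≡-mod-reflexive (sym (+-identityʳ 1ℤ))
  ∏-+-even (suc L) {f} {t} 2∣t f-odd = begin
    (f 0 + t) * ∏ L (λ i → f (suc i) + t) ≈⟨ *-congˡ-mod (f 0 + t) (∏-+-even L 2∣t (λ i → f-odd (suc i))) ⟩
    (f 0 + t) * (P + + L * t)              ≈⟨ congruent (subst (_ ∣_) (expand (f 0) P t (+ L)) divisible) ⟩
    f 0 * P + (1ℤ + + L) * t               ≡⟨ cong (λ k → f 0 * P + k * t) (pos-+ 1 L) ⟨
    f 0 * P + + suc L * t                  ∎
    where
    open ≡-mod-Reasoning (+ 2 * t)
    P = ∏ L (λ i → f (suc i))
    expand : ∀ a b t ℓ → (a - 1ℤ) * t * ℓ + (b - 1ℤ) * t + t * t * ℓ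
                       ≡ (a + t) * (b + ℓ * t) - (a * b + (1ℤ + ℓ) * t)
    expand = solve-∀
    divisible : + 2 * t ∣ (f 0 - 1ℤ) * t * + L + (P - 1ℤ) * t + t * t * + L
    divisible = ∣m∣n⇒∣m+n (∣m∣n⇒∣m+n (∣m⇒∣m*n (+ L) (*-monoˡ-∣ t (divides-difference (f-odd 0))))
                                    (*-monoˡ-∣ t (divides-difference (∏-Odd L (λ i → f-odd (suc i))))))
                          (∣m⇒∣m*n (+ L) (*-monoˡ-∣ t 2∣t))

  odd : ℕ → ℤ
  odd i = 1ℤ + + 2 * + i

  odd-suc : ∀ i → odd (suc i) ≡ odd i + + 2
  odd-suc i = trans (cong (λ x → 1ℤ + + 2 * x) (pos-+ 1 i)) (shift (+ i))
    where
    shift : ∀ x → 1ℤ + + 2 * (1ℤ + x) ≡ 1ℤ + + 2 * x + + 2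
    shift = solve-∀

  pos-odd : ∀ c → + (1 ℕ.+ 2 ℕ.* c) ≡ odd c
  pos-odd c = cong (λ x → 1ℤ + x) (pos-* 2 c)

  odd-Odd : ∀ i → Odd (odd i)
  odd-Odd i = congruent (divides (+ i) (twice (+ i)))
    where
    twice : ∀ x → 1ℤ + + 2 * x - 1ℤ ≡ x * + 2
    twice = solve-∀

  pos-^ : ∀ m k → + (m ℕ.^ k) ≡ (+ m) ^ k
  pos-^ m zero    = refl
  pos-^ m (suc k) = trans (pos-* m (m ℕ.^ k)) (cong (+ m *_) (pos-^ m k))

  oddDF≡∏odd : ∀ n → + oddDF n ≡ ∏ n odd
  oddDF≡∏odd zero    = refl
  oddDF≡∏odd (suc n) = begin
    + (oddDF n ℕ.* (2 ℕ.* n ℕ.+ 1))  ≡⟨ pos-* (oddDF n) (2 ℕ.* n ℕ.+ 1) ⟩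
    + oddDF n * + (2 ℕ.* n ℕ.+ 1)    ≡⟨ cong₂ _*_ (oddDF≡∏odd n) (trans (cong +_ (ℕ.+-comm _ 1)) (pos-odd n)) ⟩
    ∏ n odd * odd n                  ≡⟨ ∏-suc n odd ⟨
    ∏ (suc n) odd                    ∎
    where open ≡-Reasoning

  ∏-odd-reflect : ∀ L → ∏ L (λ i → odd i - + 2 * + L) ≡ -1ℤ ^ L * ∏ L odd
  ∏-odd-reflect zero    = refl
  ∏-odd-reflect (suc L) = begin
    (odd 0 - + 2 * + suc L) * ∏ L (λ i → odd (suc i) - + 2 * + suc L)
      ≡⟨ cong₂ _*_ (first (+ L)) (∏-cong L reflected-suc) ⟩
    - odd L * ∏ L (λ i → odd i - + 2 * + L)
      ≡⟨ cong (- odd L *_) (∏-odd-reflect L) ⟩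
    - odd L * (-1ℤ ^ L * ∏ L odd)
      ≡⟨ rearrange (odd L) (-1ℤ ^ L) (∏ L odd) ⟩
    -1ℤ ^ suc L * (∏ L odd * odd L)
      ≡⟨ cong (-1ℤ ^ suc L *_) (∏-suc L odd) ⟨
    -1ℤ ^ suc L * ∏ (suc L) odd
      ∎
    where
    open ≡-Reasoning
    first : ∀ ℓ → 1ℤ + + 2 * + 0 - + 2 * (1ℤ + ℓ) ≡ - (1ℤ + + 2 * ℓ)
    first = solve-∀
    shifted : ∀ o ℓ → o + + 2 - + 2 * (1ℤ + ℓ) ≡ o - + 2 * ℓ
    shifted = solve-∀
    reflected-suc : ∀ i → odd (suc i) - + 2 * + suc L ≡ odd i - + 2 * + L
    reflected-suc i = trans (cong₂ (λ o ℓ → o - + 2 * ℓ) (odd-suc i) (pos-+ 1 L)) (shifted (odd i) (+ L))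
    rearrange : ∀ o e P → - o * (e * P) ≡ -1ℤ * e * (P * o)
    rearrange = solve-∀

  -- 2(L + i) + 1 = (2i + 1 − 2L) + 4L, and the factors 2i + 1 − 2L are −(2L − 1), …, −3, −1.
  ∏-odd-double : ∀ L →
    ∏ (2 ℕ.* L) odd ≡ ∏ L odd * (-1ℤ ^ L * ∏ L odd + + L * (+ 4 * + L)) mod (+ 2 * (+ 4 * + L))
  ∏-odd-double L = begin
    ∏ (2 ℕ.* L) odd
      ≡⟨ cong (λ k → ∏ (L ℕ.+ k) odd) (ℕ.+-identityʳ L) ⟩
    ∏ (L ℕ.+ L) odd
      ≡⟨ ∏-+ L L odd ⟩
    ∏ L odd * ∏ L (λ i → odd (L ℕ.+ i))
      ≡⟨ cong (∏ L odd *_) (∏-cong L reflected) ⟩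
    ∏ L odd * ∏ L (λ i → odd i - + 2 * + L + + 4 * + L)
      ≈⟨ *-congˡ-mod (∏ L odd) (∏-+-even L 2∣4L odd-reflected) ⟩
    ∏ L odd * (∏ L (λ i → odd i - + 2 * + L) + + L * (+ 4 * + L))
      ≡⟨ cong (λ x → ∏ L odd * (x + + L * (+ 4 * + L))) (∏-odd-reflect L) ⟩
    ∏ L odd * (-1ℤ ^ L * ∏ L odd + + L * (+ 4 * + L))
      ∎
    where
    open ≡-mod-Reasoning (+ 2 * (+ 4 * + L))
    shift : ∀ ℓ x → 1ℤ + + 2 * (ℓ + x) ≡ 1ℤ + + 2 * x - + 2 * ℓ + + 4 * ℓ
    shift = solve-∀
    reflected : ∀ i → odd (L ℕ.+ i) ≡ odd i - + 2 * + L + + 4 * + L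
    reflected i = trans (cong (λ x → 1ℤ + + 2 * x) (pos-+ L i)) (shift (+ L) (+ i))
    double : ∀ ℓ → + 4 * ℓ ≡ + 2 * ℓ * + 2
    double = solve-∀
    2∣4L : + 2 ∣ + 4 * + L
    2∣4L = divides (+ 2 * + L) (double (+ L))
    difference : ∀ x ℓ → 1ℤ + + 2 * x - + 2 * ℓ - 1ℤ ≡ (x - ℓ) * + 2
    difference = solve-∀
    odd-reflected : ∀ i → Odd (odd i - + 2 * + L)
    odd-reflected i = congruent (divides (+ i - + L) (difference (+ i) (+ L)))

  ∏-odd-+2 : ∀ n → ∏ (2 ℕ.+ n) odd ≡ - ∏ n odd mod + 4
  ∏-odd-+2 n = begin
    ∏ (2 ℕ.+ n) odd
      ≡⟨ trans (∏-suc (suc n) odd) (cong (_* odd (suc n)) (∏-suc n odd)) ⟩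
    ∏ n odd * odd n * odd (suc n)
      ≡⟨ trans (*-assoc (∏ n odd) (odd n) _) (cong (λ o → ∏ n odd * (odd n * o)) (odd-suc n)) ⟩
    ∏ n odd * (odd n * (odd n + + 2))
      ≈⟨ *-congˡ-mod (∏ n odd) (congruent (divides (+ n * + n + + 2 * + n + 1ℤ) (consecutive (+ n)))) ⟩
    ∏ n odd * -1ℤ
      ≡⟨ trans (*-comm (∏ n odd) -1ℤ) (-1*i≡-i (∏ n odd)) ⟩
    - ∏ n odd
      ∎
    where
    open ≡-mod-Reasoning (+ 4)
    consecutive : ∀ x → (1ℤ + + 2 * x) * (1ℤ + + 2 * x + + 2) - -1ℤ ≡ (x * x + + 2 * x + 1ℤ) * + 4
    consecutive = solve-∀

  ∏-odd-+4 : ∀ n → ∏ (4 ℕ.+ n) odd ≡ ∏ n odd mod + 4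
  ∏-odd-+4 n = begin
    ∏ (2 ℕ.+ (2 ℕ.+ n)) odd   ≈⟨ ∏-odd-+2 (2 ℕ.+ n) ⟩
    - ∏ (2 ℕ.+ n) odd         ≈⟨ -‿cong-mod (∏-odd-+2 n) ⟩
    - - ∏ n odd               ≡⟨ neg-involutive (∏ n odd) ⟩
    ∏ n odd                   ∎
    where open ≡-mod-Reasoning (+ 4)

  sgn : ℕ → ℤ
  sgn n = if signExp n ℕ.% 2 ℕ.≡ᵇ 0 then 1ℤ else -1ℤ

  sgn-±1 : ∀ n → sgn n ≡ 1ℤ ⊎ sgn n ≡ -1ℤ
  sgn-±1 n with signExp n ℕ.% 2 ℕ.≡ᵇ 0
  ... | true  = inj₁ refl
  ... | false = inj₂ refl

  signExp-+4 : ∀ m → signExp (5 ℕ.+ m) ℕ.% 2 ≡ signExp (suc m) ℕ.% 2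
  signExp-+4 zero    = refl
  signExp-+4 (suc k) = begin
    (5 ℕ.+ k) ℕ.* (4 ℕ.+ k) ℕ./ 2 ℕ.% 2
      ≡⟨ cong (λ x → x ℕ./ 2 ℕ.% 2) (expand k) ⟩
    (T ℕ.+ e ℕ.* 2) ℕ./ 2 ℕ.% 2
      ≡⟨ cong (ℕ._% 2) (ℕ.+-distrib-/-∣ʳ T (ℕ.n∣m*n e)) ⟩
    (T ℕ./ 2 ℕ.+ e ℕ.* 2 ℕ./ 2) ℕ.% 2
      ≡⟨ cong (λ x → (T ℕ./ 2 ℕ.+ x) ℕ.% 2) (ℕ.m*n/n≡m e 2) ⟩
    (T ℕ./ 2 ℕ.+ (2 ℕ.* k ℕ.+ 5) ℕ.* 2) ℕ.% 2
      ≡⟨ ℕ.[m+kn]%n≡m%n (T ℕ./ 2) (2 ℕ.* k ℕ.+ 5) 2 ⟩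
    T ℕ./ 2 ℕ.% 2
      ∎
    where
    open ≡-Reasoning
    T = suc k ℕ.* k
    e = (2 ℕ.* k ℕ.+ 5) ℕ.* 2
    expand : ∀ k → (5 ℕ.+ k) ℕ.* (4 ℕ.+ k) ≡ suc k ℕ.* k ℕ.+ (2 ℕ.* k ℕ.+ 5) ℕ.* 2 ℕ.* 2
    expand = ℕ-solve-∀

  sgn-+4 : ∀ m → sgn (4 ℕ.+ suc m) ≡ sgn (suc m)
  sgn-+4 m = cong (λ b → if b ℕ.≡ᵇ 0 then 1ℤ else -1ℤ) (signExp-+4 m)

  sgn-periodic : ∀ q r → sgn (q ℕ.* 4 ℕ.+ suc r) ≡ sgn (suc r)
  sgn-periodic zero    r = refl
  sgn-periodic (suc q) r = begin
    sgn (4 ℕ.+ (q ℕ.* 4 ℕ.+ suc r))   ≡⟨ cong (λ m → sgn (4 ℕ.+ m)) (ℕ.+-suc (q ℕ.* 4) r) ⟩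
    sgn (4 ℕ.+ suc (q ℕ.* 4 ℕ.+ r))   ≡⟨ sgn-+4 (q ℕ.* 4 ℕ.+ r) ⟩
    sgn (suc (q ℕ.* 4 ℕ.+ r))         ≡⟨ cong sgn (ℕ.+-suc (q ℕ.* 4) r) ⟨
    sgn (q ℕ.* 4 ℕ.+ suc r)           ≡⟨ sgn-periodic q r ⟩
    sgn (suc r)                       ∎
    where open ≡-Reasoning

  -1^-double : ∀ k → -1ℤ ^ (2 ℕ.* k) ≡ 1ℤ
  -1^-double k = trans (sym (^-*-assoc -1ℤ 2 k)) (^-zeroˡ k)

  2^_ : ℕ → ℤ
  2^ k = (+ 2) ^ k

  NumeratorResidue : ℕ → ℕ → Set
  NumeratorResidue n a = ∏ n odd + sgn n ≡ 2^ suc a mod 2^ (2 ℕ.+ a)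

  -- With s = ±1: (2p − s)² = 4p² + 4p + 1 − 4p(1 + s), and 1 + s ∈ {0, 2}.
  square-near-sign : ∀ {P s} p → s ≡ 1ℤ ⊎ s ≡ -1ℤ → P + s ≡ + 2 * p mod + 2 * (+ 2 * p) →
                     P * P ≡ + 4 * p * p + + 4 * p + 1ℤ mod + 2 * (+ 2 * (+ 2 * p))
  square-near-sign {P} {s} p s≡±1 P+s≡2p =
    ≡-mod-trans (square-doubling (divides (+ 2 * p) (4p≡2p*2 p)) P≡2p-s) (square-2p-s s≡±1)
    where
    cancel : ∀ P s → P ≡ P + s - s
    cancel = solve-∀
    4p≡2p*2 : ∀ p → + 2 * (+ 2 * p) ≡ + 2 * p * + 2
    4p≡2p*2 = solve-∀
    P≡2p-s : P ≡ + 2 * p - s mod + 2 * (+ 2 * p)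
    P≡2p-s = begin
      P             ≡⟨ cancel P s ⟩
      P + s - s     ≈⟨ +-congʳ-mod (- s) P+s≡2p ⟩
      + 2 * p - s   ∎
      where open ≡-mod-Reasoning (+ 2 * (+ 2 * p))
    expand₊ : ∀ p → (+ 2 * p - 1ℤ) * (+ 2 * p - 1ℤ) - (+ 4 * p * p + + 4 * p + 1ℤ)
                  ≡ -1ℤ * (+ 2 * (+ 2 * (+ 2 * p)))
    expand₊ = solve-∀
    expand₋ : ∀ p → (+ 2 * p - -1ℤ) * (+ 2 * p - -1ℤ) ≡ + 4 * p * p + + 4 * p + 1ℤ
    expand₋ = solve-∀
    square-2p-s : s ≡ 1ℤ ⊎ s ≡ -1ℤ →
                  (+ 2 * p - s) * (+ 2 * p - s) ≡ + 4 * p * p + + 4 * p + 1ℤ mod + 2 * (+ 2 * (+ 2 * p))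
    square-2p-s (inj₁ refl) = congruent (divides -1ℤ (expand₊ p))
    square-2p-s (inj₂ refl) = ≡-mod-reflexive (expand₋ p)

  ∏-odd-double-mod : ∀ a L → 2^ a ∣ + L → NumeratorResidue L a →
    ∏ (2 ℕ.* L) odd ≡ -1ℤ ^ L * (+ 4 * 2^ a * 2^ a + + 4 * 2^ a + 1ℤ) + + 4 * (+ L * + L * ∏ L odd)
                      mod 2^ (3 ℕ.+ a)
  ∏-odd-double-mod a L (divides q L≡q*p) residue = begin
    ∏ (2 ℕ.* L) odd                                       ≈⟨ ≡-mod-weaken 8p∣8L (∏-odd-double L) ⟩
    P * (-1ℤ ^ L * P + + L * (+ 4 * + L))                 ≡⟨ expand P (-1ℤ ^ L) (+ L) ⟩
    -1ℤ ^ L * (P * P) + + 4 * (+ L * + L * P)             ≈⟨ +-congʳ-mod _ (*-congˡ-mod (-1ℤ ^ L) P²) ⟩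
    -1ℤ ^ L * (+ 4 * 2^ a * 2^ a + + 4 * 2^ a + 1ℤ) + + 4 * (+ L * + L * P) ∎
    where
    open ≡-mod-Reasoning (2^ (3 ℕ.+ a))
    P = ∏ L odd
    P² : P * P ≡ + 4 * 2^ a * 2^ a + + 4 * 2^ a + 1ℤ mod 2^ (3 ℕ.+ a)
    P² = square-near-sign {P} (2^ a) (sgn-±1 L) residue
    expand : ∀ P e ℓ → P * (e * P + ℓ * (+ 4 * ℓ)) ≡ e * (P * P) + + 4 * (ℓ * ℓ * P)
    expand = solve-∀
    regroup : ∀ q p → + 2 * (+ 4 * (q * p)) ≡ q * (+ 2 * (+ 2 * (+ 2 * p)))
    regroup = solve-∀
    8p∣8L : 2^ (3 ℕ.+ a) ∣ + 2 * (+ 4 * + L)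
    8p∣8L = divides q (trans (cong (λ ℓ → + 2 * (+ 4 * ℓ)) L≡q*p) (regroup q (2^ a)))

  sgn-*4 : ∀ m → .{{ℕ.NonZero m}} → sgn (m ℕ.* 4) ≡ -1ℤ
  sgn-*4 (suc k) = trans (cong sgn (ℕ.+-comm 4 (k ℕ.* 4))) (sgn-periodic k 3)

  residue-odd : ∀ c → NumeratorResidue (1 ℕ.+ 2 ℕ.* c) 0
  residue-odd zero          = ≡-mod-refl
  residue-odd (suc zero)    = congruent (divides (+ 3) refl)
  residue-odd (suc (suc c)) = subst (λ n → NumeratorResidue n 0) (sym (index c)) (begin
    ∏ (4 ℕ.+ n) odd + sgn (4 ℕ.+ n)  ≈⟨ +-cong-mod (∏-odd-+4 n) (≡-mod-reflexive (sgn-+4 (2 ℕ.* c))) ⟩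
    ∏ n odd + sgn n                  ≈⟨ residue-odd c ⟩
    + 2                              ∎)
    where
    open ≡-mod-Reasoning (+ 4)
    n = 1 ℕ.+ 2 ℕ.* c
    index : ∀ c → 1 ℕ.+ 2 ℕ.* (2 ℕ.+ c) ≡ 4 ℕ.+ (1 ℕ.+ 2 ℕ.* c)
    index = ℕ-solve-∀

  residue-twice-odd : ∀ c → NumeratorResidue (2 ℕ.* (1 ℕ.+ 2 ℕ.* c)) 1
  residue-twice-odd c = begin
    ∏ (2 ℕ.* L) odd + sgn (2 ℕ.* L)  ≈⟨ +-congʳ-mod _ (∏-odd-double-mod 0 L 1∣L (residue-odd c)) ⟩
    -1ℤ ^ L * + 9 + + 4 * X + sgn (2 ℕ.* L)
                                     ≡⟨ cong₂ (λ e s → e * + 9 + + 4 * X + s) (cong (-1ℤ *_) (-1^-double c)) sgn-2L ⟩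
    -1ℤ * + 9 + + 4 * X + 1ℤ          ≈⟨ +-congʳ-mod 1ℤ (+-congˡ-mod (-1ℤ * + 9) (*-scale-mod (+ 4) X-odd)) ⟩
    -1ℤ * + 9 + + 4 * 1ℤ + 1ℤ         ≈⟨ congruent (divides -1ℤ refl) ⟩
    + 4                              ∎
    where
    open ≡-mod-Reasoning (+ 8)
    L = 1 ℕ.+ 2 ℕ.* c
    X = + L * + L * ∏ L odd
    1∣L : 2^ 0 ∣ + L
    1∣L = divides (+ L) (sym (*-identityʳ (+ L)))
    L-odd : Odd (+ L)
    L-odd = subst Odd (sym (pos-odd c)) (odd-Odd c)
    X-odd : Odd X
    X-odd = *-cong-mod (*-cong-mod L-odd L-odd) (∏-Odd L odd-Odd)
    index : ∀ c → 2 ℕ.* (1 ℕ.+ 2 ℕ.* c) ≡ c ℕ.* 4 ℕ.+ 2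
    index = ℕ-solve-∀
    sgn-2L : sgn (2 ℕ.* L) ≡ 1ℤ
    sgn-2L = trans (cong sgn (index c)) (sgn-periodic c 1)

  residue-double : ∀ a c → NumeratorResidue (2 ℕ.^ suc a ℕ.* (1 ℕ.+ 2 ℕ.* c)) (suc a) →
                        NumeratorResidue (2 ℕ.* (2 ℕ.^ suc a ℕ.* (1 ℕ.+ 2 ℕ.* c))) (2 ℕ.+ a)
  residue-double a c residue = begin
    ∏ (2 ℕ.* L) odd + sgn (2 ℕ.* L)
      ≈⟨ +-congʳ-mod _ (∏-odd-double-mod (suc a) L p∣L residue) ⟩
    -1ℤ ^ L * (+ 4 * p * p + + 4 * p + 1ℤ) + + 4 * X + sgn (2 ℕ.* L)
      ≡⟨ cong₂ (λ e s → e * (+ 4 * p * p + + 4 * p + 1ℤ) + + 4 * X + s) -1^L≡1 sgn-2L ⟩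
    1ℤ * (+ 4 * p * p + + 4 * p + 1ℤ) + + 4 * X + -1ℤ
      ≈⟨ +-congʳ-mod -1ℤ (+-cong-mod (*-congˡ-mod 1ℤ (+-congʳ-mod 1ℤ (+-congʳ-mod (+ 4 * p) 4p²≡0))) 4X≡0) ⟩
    1ℤ * (+ 0 + + 4 * p + 1ℤ) + + 0 + -1ℤ
      ≡⟨ simplify q ⟩
    2^ (3 ℕ.+ a)
      ∎
    where
    open ≡-mod-Reasoning (2^ (4 ℕ.+ a))
    o = 1 ℕ.+ 2 ℕ.* c
    L = 2 ℕ.^ suc a ℕ.* o
    q = 2^ a
    p = 2^ suc a
    P = ∏ L odd
    X = + L * + L * P
    L≡p*o : + L ≡ p * + o
    L≡p*o = trans (pos-* (2 ℕ.^ suc a) o) (cong (_* + o) (pos-^ 2 (suc a)))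
    p∣L : p ∣ + L
    p∣L = divides (+ o) (trans L≡p*o (*-comm p (+ o)))
    -1^L≡1 : -1ℤ ^ L ≡ 1ℤ
    -1^L≡1 = trans (cong (-1ℤ ^_) (ℕ.*-assoc 2 (2 ℕ.^ a) o)) (-1^-double (2 ℕ.^ a ℕ.* o))
    index : ∀ x o → 2 ℕ.* (2 ℕ.* x ℕ.* o) ≡ x ℕ.* o ℕ.* 4
    index = ℕ-solve-∀
    sgn-2L : sgn (2 ℕ.* L) ≡ -1ℤ
    sgn-2L = trans (cong sgn (index (2 ℕ.^ a) o))
                   (sgn-*4 (2 ℕ.^ a ℕ.* o) {{ℕ.m*n≢0 (2 ℕ.^ a) o {{ℕ.m^n≢0 2 a}}}})
    4p² : ∀ q → + 4 * (+ 2 * q) * (+ 2 * q) ≡ q * (+ 2 * (+ 2 * (+ 2 * (+ 2 * q))))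
    4p² = solve-∀
    4p²≡0 : + 4 * p * p ≡ + 0 mod 2^ (4 ℕ.+ a)
    4p²≡0 = multiple≡0-mod (divides q (4p² q))
    4X : ∀ q o P → + 4 * ((+ 2 * q) * o * ((+ 2 * q) * o) * P) ≡ q * o * o * P * (+ 2 * (+ 2 * (+ 2 * (+ 2 * q))))
    4X = solve-∀
    4X≡0 : + 4 * X ≡ + 0 mod 2^ (4 ℕ.+ a)
    4X≡0 = multiple≡0-mod (divides (q * + o * + o * P)
             (trans (cong (λ ℓ → + 4 * (ℓ * ℓ * P)) L≡p*o) (4X q (+ o) P)))
    simplify : ∀ q → 1ℤ * (+ 0 + + 4 * (+ 2 * q) + 1ℤ) + + 0 + -1ℤ ≡ + 2 * (+ 2 * (+ 2 * q))
    simplify = solve-∀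

  residue-2^a*odd : ∀ a c → NumeratorResidue (2 ℕ.^ a ℕ.* (1 ℕ.+ 2 ℕ.* c)) a
  residue-2^a*odd zero          c =
    subst (λ n → NumeratorResidue n 0) (sym (ℕ.*-identityˡ (1 ℕ.+ 2 ℕ.* c))) (residue-odd c)
  residue-2^a*odd (suc zero)    c = residue-twice-odd c
  residue-2^a*odd (suc (suc a)) c = subst (λ n → NumeratorResidue n (2 ℕ.+ a))
    (sym (ℕ.*-assoc 2 (2 ℕ.^ suc a) (1 ℕ.+ 2 ℕ.* c)))
    (residue-double a c (residue-2^a*odd (suc a) c))

  oddDF-nonZero : ∀ n → ℕ.NonZero (oddDF n)
  oddDF-nonZero zero    = _
  oddDF-nonZero (suc n) =
    ℕ.m*n≢0 (oddDF n) (2 ℕ.* n ℕ.+ 1) {{oddDF-nonZero n}} {{ℕ.>-nonZero (ℕ.m≤n+m 1 (2 ℕ.* n))}}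

  pos-if-±1 : ∀ b P → .{{ℕ.NonZero P}} → + (if b then P ℕ.+ 1 else P ℕ.∸ 1) ≡ + P + (if b then 1ℤ else -1ℤ)
  pos-if-±1 true  P       = pos-+ P 1
  pos-if-±1 false (suc P) = refl

  numerator-pos : ∀ n x → + numerator n x ≡ + (oddDF n ℕ.^ x) + sgn n
  numerator-pos n x =
    pos-if-±1 (signExp n ℕ.% 2 ℕ.≡ᵇ 0) (oddDF n ℕ.^ x) {{ℕ.m^n≢0 (oddDF n) x {{oddDF-nonZero n}}}}

  numerator-residue : ∀ k a c →
    + numerator (2 ℕ.^ a ℕ.* (1 ℕ.+ 2 ℕ.* c)) (2 ℕ.* k ℕ.+ 1) ≡ 2^ suc a mod 2^ (2 ℕ.+ a)
  numerator-residue k a c = begin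
    + numerator n x              ≡⟨ numerator-pos n x ⟩
    + (oddDF n ℕ.^ x) + sgn n    ≡⟨ cong (_+ sgn n) (trans (pos-^ (oddDF n) x) (cong (_^ x) (oddDF≡∏odd n))) ⟩
    A ^ x + sgn n                ≡⟨ cong (λ e → A ^ e + sgn n) (ℕ.+-comm (2 ℕ.* k) 1) ⟩
    A ^ (1 ℕ.+ 2 ℕ.* k) + sgn n  ≈⟨ +-congʳ-mod (sgn n) (^-odd-mod A k A²≡1) ⟩
    A + sgn n                    ≈⟨ residue-2^a*odd a c ⟩
    2^ suc a                     ∎
    where
    open ≡-mod-Reasoning (2^ (2 ℕ.+ a))
    n = 2 ℕ.^ a ℕ.* (1 ℕ.+ 2 ℕ.* c)
    x = 2 ℕ.* k ℕ.+ 1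
    A = ∏ n odd
    square-residue : ∀ p → + 4 * p * p + + 4 * p + 1ℤ - 1ℤ ≡ (p + 1ℤ) * (+ 2 * (+ 2 * p))
    square-residue = solve-∀
    A²≡1 : A * A ≡ 1ℤ mod 2^ (2 ℕ.+ a)
    A²≡1 = ≡-mod-trans
      (≡-mod-weaken (divides (+ 2) refl) (square-near-sign {A} (2^ a) (sgn-±1 n) (residue-2^a*odd a c)))
      (congruent (divides (2^ a + 1ℤ) (square-residue (2^ a))))

  pos-≡-mod⇒quotient : ∀ {N M K} → + N ≡ + M mod + K → M ℕ.< K → ∃ λ u → N ≡ M ℕ.+ u ℕ.* K
  pos-≡-mod⇒quotient {N} {M} {K} (congruent (divides (+ u) N-M≡uK)) _ = u , +-injective (begin
    + N                    ≡⟨ move (+ N) (+ M) ⟩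
    + M + (+ N - + M)      ≡⟨ cong (λ d → + M + d) N-M≡uK ⟩
    + M + + u * + K        ≡⟨ cong (λ d → + M + d) (pos-* u K) ⟨
    + M + + (u ℕ.* K)      ≡⟨ pos-+ M (u ℕ.* K) ⟨
    + (M ℕ.+ u ℕ.* K)      ∎)
    where
    open ≡-Reasoning
    move : ∀ N M → N ≡ M + (N - M)
    move = solve-∀
  pos-≡-mod⇒quotient {N} {M} {K} (congruent (divides -[1+ r ] N-M≡-[1+r]K)) M<K = ⊥-elim (ℕ.<⇒≱ M<K K≤M)
    where
    open ≡-Reasoning
    move : ∀ N M x K → N - M ≡ (- x) * K → M ≡ N + x * K
    move N M x K eq = trans (undo N M) (trans (cong (λ d → N - d) eq) (negate N x K))
      where
      undo : ∀ N M → M ≡ N - (N - M)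
      undo = solve-∀
      negate : ∀ N x K → N - (- x) * K ≡ N + x * K
      negate = solve-∀
    M≡N+[1+r]K : M ≡ N ℕ.+ suc r ℕ.* K
    M≡N+[1+r]K = +-injective (begin
      + M                    ≡⟨ move (+ N) (+ M) (+ suc r) (+ K) N-M≡-[1+r]K ⟩
      + N + + suc r * + K    ≡⟨ cong (λ d → + N + d) (pos-* (suc r) K) ⟨
      + N + + (suc r ℕ.* K)  ≡⟨ pos-+ N (suc r ℕ.* K) ⟨
      + (N ℕ.+ suc r ℕ.* K)  ∎)
    K≤M : K ℕ.≤ M
    K≤M = subst (K ℕ.≤_) (sym M≡N+[1+r]K) (ℕ.≤-trans (ℕ.m≤m+n K (r ℕ.* K)) (ℕ.m≤n+m (suc r ℕ.* K) N))

  numerator≡2^[1+a]*odd : ∀ k a c → ∃ λ u →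
    numerator (2 ℕ.^ a ℕ.* (1 ℕ.+ 2 ℕ.* c)) (2 ℕ.* k ℕ.+ 1) ≡ 2 ℕ.^ a ℕ.* (1 ℕ.+ 2 ℕ.* u) ℕ.* 2
  numerator≡2^[1+a]*odd k a c =
    map₂ (λ {u} N≡ → trans N≡ (regroup (2 ℕ.^ a) u)) (pos-≡-mod⇒quotient residueℕ 2^[1+a]<2^[2+a])
    where
    n = 2 ℕ.^ a ℕ.* (1 ℕ.+ 2 ℕ.* c)
    x = 2 ℕ.* k ℕ.+ 1
    residueℕ : + numerator n x ≡ + (2 ℕ.^ suc a) mod + (2 ℕ.^ (2 ℕ.+ a))
    residueℕ = subst₂ (λ r m → + numerator n x ≡ r mod m) (sym (pos-^ 2 (suc a))) (sym (pos-^ 2 (2 ℕ.+ a)))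
                      (numerator-residue k a c)
    2^[1+a]<2^[2+a] : 2 ℕ.^ suc a ℕ.< 2 ℕ.^ (2 ℕ.+ a)
    2^[1+a]<2^[2+a] = ℕ.^-monoʳ-< 2 (ℕ.n<1+n 1) (ℕ.n<1+n (suc a))
    regroup : ∀ p u → 2 ℕ.* p ℕ.+ u ℕ.* (2 ℕ.* (2 ℕ.* p)) ≡ p ℕ.* (1 ℕ.+ 2 ℕ.* u) ℕ.* 2
    regroup = ℕ-solve-∀

open Congruences using (numerator≡2^[1+a]*odd)

open import Data.Nat using (ℕ; zero; suc; _+_; _*_; _^_; _/_; _%_; _≡ᵇ_; _≤_; _<_; NonZero; z≤n; s≤s)
open import Data.Nat.Induction using (<-rec)

2^a*odd≢0 : ∀ a c → NonZero (2 ^ a * (1 + 2 * c))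
2^a*odd≢0 a c = ℕ.m*n≢0 (2 ^ a) (1 + 2 * c) {{ℕ.m^n≢0 2 a}}

even-or-odd : ∀ n → (∃ λ m → n ≡ 2 * m) ⊎ (∃ λ c → n ≡ 1 + 2 * c)
even-or-odd zero    = inj₁ (0 , refl)
even-or-odd (suc n) with even-or-odd n
... | inj₁ (m , refl) = inj₂ (m , refl)
... | inj₂ (c , refl) = inj₁ (suc c , carry c)
  where
  carry : ∀ c → 2 + 2 * c ≡ 2 * suc c
  carry = ℕ-solve-∀

2^a*odd-decomposition : ∀ n → 1 ≤ n → ∃₂ λ a c → n ≡ 2 ^ a * (1 + 2 * c)
2^a*odd-decomposition = <-rec _ decompose
  where
  decompose : ∀ n → (∀ {m} → m < n → 1 ≤ m → ∃₂ λ a c → m ≡ 2 ^ a * (1 + 2 * c)) →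
              1 ≤ n → ∃₂ λ a c → n ≡ 2 ^ a * (1 + 2 * c)
  decompose n rec 1≤n with even-or-odd n
  ... | inj₂ (c , refl)     = 0 , c , sym (ℕ.*-identityˡ (1 + 2 * c))
  ... | inj₁ (suc m , refl) with rec (ℕ.m<m+n (suc m) (s≤s z≤n)) (s≤s z≤n)
  ...   | a , c , m≡       = suc a , c , trans (cong (2 *_) m≡) (sym (ℕ.*-assoc 2 (2 ^ a) (1 + 2 * c)))

ν₂-aux-odd : ∀ f c → ν₂-aux (suc f) (1 + 2 * c) ≡ 0
ν₂-aux-odd f c = cong (λ r → if r ≡ᵇ 0 then suc (ν₂-aux f ((1 + 2 * c) / 2)) else 0)
                      (trans (cong (λ e → (1 + e) % 2) (ℕ.*-comm 2 c)) (ℕ.[m+kn]%n≡m%n 1 c 2))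

ν₂-aux-double : ∀ f m → .{{NonZero m}} → ν₂-aux (suc f) (2 * m) ≡ suc (ν₂-aux f m)
ν₂-aux-double f m@(suc _) = cong₂ (λ r h → if r ≡ᵇ 0 then suc (ν₂-aux f h) else 0)
  (trans (cong (_% 2) (ℕ.*-comm 2 m)) (ℕ.m*n%n≡0 m 2))
  (trans (cong (_/ 2) (ℕ.*-comm 2 m)) (ℕ.m*n/n≡m m 2))

ν₂-aux-2^a*odd : ∀ a c {f} → 2 ^ a * (1 + 2 * c) ≤ f → ν₂-aux f (2 ^ a * (1 + 2 * c)) ≡ a
ν₂-aux-2^a*odd a c {zero} m≤0 = ⊥-elim (ℕ.<⇒≱ (ℕ.>-nonZero⁻¹ _ {{2^a*odd≢0 a c}}) m≤0)
ν₂-aux-2^a*odd zero c {suc f} _ = trans (cong (ν₂-aux (suc f)) (ℕ.*-identityˡ (1 + 2 * c))) (ν₂-aux-odd f c)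
ν₂-aux-2^a*odd (suc a) c {suc f} 2m≤1+f = begin
  ν₂-aux (suc f) (2 * 2 ^ a * (1 + 2 * c))  ≡⟨ cong (ν₂-aux (suc f)) (ℕ.*-assoc 2 (2 ^ a) (1 + 2 * c)) ⟩
  ν₂-aux (suc f) (2 * m)                    ≡⟨ ν₂-aux-double f m {{2^a*odd≢0 a c}} ⟩
  suc (ν₂-aux f m)                          ≡⟨ cong suc (ν₂-aux-2^a*odd a c m≤f) ⟩
  suc a                                     ∎
  where
  open ≡-Reasoning
  m = 2 ^ a * (1 + 2 * c)
  m≤f : m ≤ f
  m≤f = ℕ.≤-pred (ℕ.<-≤-trans m<2m (subst (_≤ suc f) (ℕ.*-assoc 2 (2 ^ a) (1 + 2 * c)) 2m≤1+f))
    where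
    m<2m : m < 2 * m
    m<2m = subst (m <_) (ℕ.*-comm m 2) (ℕ.m<m*n m 2 {{2^a*odd≢0 a c}} (ℕ.n<1+n 1))

ν₂-2^a*odd : ∀ a c → ν₂ (2 ^ a * (1 + 2 * c)) ≡ a
ν₂-2^a*odd a c = ν₂-aux-2^a*odd a c ℕ.≤-refl

ν₂-numerator-half : ∀ k a c → ν₂ (numerator (2 ^ a * (1 + 2 * c)) (2 * k + 1) / 2) ≡ a
ν₂-numerator-half k a c = trans (cong ν₂ half≡) (ν₂-2^a*odd a u)
  where
  u = proj₁ (numerator≡2^[1+a]*odd k a c)
  half≡ : numerator (2 ^ a * (1 + 2 * c)) (2 * k + 1) / 2 ≡ 2 ^ a * (1 + 2 * u)
  half≡ = trans (cong (_/ 2) (proj₂ (numerator≡2^[1+a]*odd k a c))) (ℕ.m*n/n≡m (2 ^ a * (1 + 2 * u)) 2)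

corollary1 : ∀ (k n : ℕ) → 1 ≤ n → ν₂ (numerator n (2 * k + 1) / 2) ≡ ν₂ n
corollary1 k n 1≤n with 2^a*odd-decomposition n 1≤n
... | a , c , refl = trans (ν₂-numerator-half k a c) (sym (ν₂-2^a*odd a c))
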